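{- Every ta-diagram is equivalent to a standard ta-diagram.
   Context: An $n$-arcdiagram is a planar diagram of $n$ pairwise non-intersecting semicircles (arcs) in the closed upper half-plane with endpoints on a horizontal line, considered up to isotopy. The arcs are indexed $a_1,\dots,a_n$ in increasing order of their right endpoints. An arc $a$ is inside an arc $b$ if it lies in the interior (the bounded region cut out by $b$ and the line) of $b$; otherwise it is outside $b$. A ta-diagram (tied arcdiagram) is an arcdiagram together with finitely many ties: each tie is a simple curve in the open upper half-plane joining a point of one arc to a point of a different arc, meeting no arc except at its two endpoints, and meeting no other tie. The ta-partition is the partition of $\{1,\dots,n\}$ into connected components of the graph on the arcs whose edges are the ties. Two ta-diagrams are equivalent if they have the same underlying arcdiagram and the same ta-partition. A ta-diagram is irreducible if any two arcs are joined by at most one tie and the ties form no cycle (no $m>2$ arcs $a_{i_1},\dots,a_{i_m}$ with ties between $a_{i_k},a_{i_{k+1}}$ for $k<m$ and between $a_{i_m},a_{i_1}$). A ta-diagram is standard if it is irreducible and, in each part of the ta-partition with indices $i_1<\dots<i_m$, every arc $a_{i_k}$ is joined by a tie to at most one arc of higher index, and to at most two arcs of lower indices, namely at most one lower-index arc outside $a_{i_k}$ and at most one lower-index arc inside $a_{i_k}$. -}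

module Defs where

open import Data.Nat as ℕ using (ℕ; suc; _≤_)
open import Data.Fin as Fin using (Fin)
open import Data.Product using (_×_; _,_; proj₁; proj₂; Σ)
open import Data.Sum using (_⊎_)
open import Data.Empty using (⊥)
open import Data.List using (List; []; _∷_; _++_; [_]; length; lookup)
open import Data.List.Relation.Unary.All using (All)
open import Data.List.Relation.Unary.Linked using (Linked)
open import Data.List.Relation.Unary.Unique.Propositional using (Unique)
open import Data.List.Membership.Propositional using (_∈_)
open import Relation.Binary.PropositionalEquality using (_≡_; _≢_)
open import Relation.Binary.Construct.Closure.ReflexiveTransitive using (Star)
open import Relation.Nullary using (¬_)

-- An n-arcdiagram up to isotopy = a noncrossing perfect matching of 2n points
-- on the line.  Arc i has left endpoint `left i` and right endpoint `right i`
-- (positions on the line, only their relative order matters); arcs are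
-- indexed in increasing order of their right endpoints.
record ArcDiagram (n : ℕ) : Set where
  field
    left right  : Fin n → ℕ
    left<right  : ∀ i → left i ℕ.< right i
    left-inj    : ∀ i j → left i ≡ left j → i ≡ j
    left≢right  : ∀ i j → left i ≢ right j
    indexing    : ∀ i j → i Fin.< j → right i ℕ.< right j
    noncrossing : ∀ i j →
      ¬ (left i ℕ.< left j × left j ℕ.< right i × right i ℕ.< right j)

open ArcDiagram public

module _ {n : ℕ} (D : ArcDiagram n) where

  Inside : Fin n → Fin n → Set
  Inside a b = left D b ℕ.< left D a × right D a ℕ.< right D b

  -- a and b lie in the same region of the upper half-plane cut out by the arcs
  SameRegion : Fin n → Fin n → Set
  SameRegion a b = ∀ c → (Inside a c → Inside b c) × (Inside b c → Inside a c)

  -- a tie (a curve in the open upper half-plane meeting no other arc) can join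
  -- a and b iff a ≢ b and no third arc separates them
  Tieable : Fin n → Fin n → Set
  Tieable a b = a ≢ b × (∀ c → c ≢ a → c ≢ b →
                  (Inside a c → Inside b c) × (Inside b c → Inside a c))

Tie : ℕ → Set
Tie n = Fin n × Fin n

Joins : {n : ℕ} → List (Tie n) → Fin n → Fin n → Set
Joins T a b = (a , b) ∈ T ⊎ (b , a) ∈ T

-- A ta-diagram on D: a finite list (multiset) of ties, each tie joining two
-- arcs that can be joined, and the ties pairwise drawable without crossing:
-- two ties {i,k}, {j,m} with i<j<k<m lying in the same region would cross.
record TaDiagram {n : ℕ} (D : ArcDiagram n) : Set where
  field
    ties     : List (Tie n)
    tieable  : All (λ t → Tieable D (proj₁ t) (proj₂ t)) ties
    noncross : ∀ i j k m → i Fin.< j → j Fin.< k → k Fin.< m →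
               Joins ties i k → Joins ties j m → SameRegion D i j → ⊥

open TaDiagram public

module _ {n : ℕ} {D : ArcDiagram n} where

  -- i and j in the same part of the ta-partition
  Connected : TaDiagram D → Fin n → Fin n → Set
  Connected T = Star (Joins (ties T))

  -- same arcdiagram (by typing) and same ta-partition
  Equivalent : TaDiagram D → TaDiagram D → Set
  Equivalent T T' = ∀ i j → (Connected T i j → Connected T' i j)
                          × (Connected T' i j → Connected T i j)

  AtMostOneTie : TaDiagram D → Set
  AtMostOneTie T = ∀ (p q : Fin (length (ties T))) →
    let a = proj₁ (lookup (ties T) p) ; b = proj₂ (lookup (ties T) p)
        c = proj₁ (lookup (ties T) q) ; d = proj₂ (lookup (ties T) q)
    in ((a ≡ c × b ≡ d) ⊎ (a ≡ d × b ≡ c)) → p ≡ q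

  NoCycle : TaDiagram D → Set
  NoCycle T = ∀ (x : Fin n) (xs : List (Fin n)) → Unique (x ∷ xs) →
    2 ≤ length xs → ¬ Linked (Joins (ties T)) (x ∷ xs ++ [ x ])

  Irreducible : TaDiagram D → Set
  Irreducible T = AtMostOneTie T × NoCycle T

  Standard : TaDiagram D → Set
  Standard T = Irreducible T
    × (∀ k j j' → k Fin.< j → k Fin.< j' →
         Joins (ties T) k j → Joins (ties T) k j' → j ≡ j')
    × (∀ k j j' → j Fin.< k → j' Fin.< k →
         Joins (ties T) j k → Joins (ties T) j' k →
         ¬ Inside D j k → ¬ Inside D j' k → j ≡ j')
    × (∀ k j j' → j Fin.< k → j' Fin.< k →
         Joins (ties T) j k → Joins (ties T) j' k →
         Inside D j k → Inside D j' k → j ≡ j')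

-- Tie every arc a upwards to at most one arc: to the first later arc of a's
-- region lying in a's part, or, if there is none, to the arc immediately
-- enclosing a when that arc lies in a's part.  These ties increase the index
-- and leave every arc at most once, so they form a forest; by construction an
-- arc receives at most one of them from its own region and at most one from
-- the region it bounds.  Every original tie joins two arcs of one region or
-- an arc to the boundary of its region, and chains of new ties join the same
-- pairs, so the ta-partition is unchanged.  Two new ties never cross: project
-- every arc onto the arc of the relevant region enclosing it; crossing new
-- ties would give four interleaved arcs of that region, alternately in two
-- different parts, and a path of original ties between two of them would
-- have to cross a path between the other two.
module Submission where

open import Defs
open import Data.Nat using (ℕ; zero; suc; s≤s; _<_; _≤_)
import Data.Nat.Properties as ℕₚ
open import Data.Fin as Fin using (Fin; toℕ)
import Data.Fin.Properties as Finₚ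
open import Data.Fin.Induction using (>-wellFounded)
open import Induction.WellFounded using (Acc; acc)
open import Data.Product as Product using (Σ; ∃; _×_; _,_; proj₁; proj₂)
open import Data.Sum as Sum using (_⊎_; inj₁; inj₂)
open import Data.Maybe using (Maybe; just; nothing)
open import Data.Maybe.Properties using (just-injective)
open import Data.Empty using (⊥; ⊥-elim)
open import Data.Unit using (⊤)
open import Data.List using (List; []; _∷_; _++_; [_]; length; lookup; allFin)
open import Data.List.Membership.Propositional using (_∈_)
open import Data.List.Membership.Propositional.Properties using (∈-allFin; ∈-lookup)
open import Data.List.Relation.Unary.Any using (here; there)
import Data.List.Relation.Unary.All as All
open import Data.List.Relation.Unary.All using (All; _∷_)
open import Data.List.Relation.Unary.AllPairs using (_∷_)
open import Data.List.Relation.Unary.Linked using (Linked; _∷_)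
open import Data.List.Relation.Unary.Unique.Propositional using (Unique)
open import Data.List.Relation.Unary.Unique.Propositional.Properties using (allFin⁺)
open import Function using (id; _∘_)
open import Relation.Nullary using (¬_; Dec; yes; no)
open import Relation.Nullary.Decidable using (_×-dec_; _⊎-dec_; _→-dec_)
open import Relation.Binary using (tri<; tri≈; tri>)
open import Relation.Binary.PropositionalEquality
  using (_≡_; _≢_; refl; sym; trans; cong; subst; subst₂)
open import Relation.Binary.Construct.Closure.ReflexiveTransitive
  using (Star; ε; _◅_; _◅◅_)
import Relation.Binary.Construct.Closure.ReflexiveTransitive as Star

Minimal : ∀ {m} → (Fin m → Set) → Fin m → Set
Minimal P x = P x × (∀ y → y Fin.< x → ¬ P y)

minimal-or-none : ∀ {m} (P : Fin m → Set) → (∀ x → Dec (P x)) →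
                  ∃ (Minimal P) ⊎ (∀ x → ¬ P x)
minimal-or-none {zero} P P? = inj₂ λ ()
minimal-or-none {suc m} P P? with P? Fin.zero
... | yes p₀ = inj₁ (Fin.zero , p₀ , λ _ ())
... | no ¬p₀ with minimal-or-none (P ∘ Fin.suc) (P? ∘ Fin.suc)
...   | inj₁ (x , px , below) =
        inj₁ (Fin.suc x , px , λ { Fin.zero _ → ¬p₀ ; (Fin.suc y) (s≤s y<x) → below y y<x })
...   | inj₂ none = inj₂ λ { Fin.zero → ¬p₀ ; (Fin.suc x) → none x }

<-exclusive⇒≡ : ∀ {m} {P : Fin m → Set} → (∀ {a b} → a Fin.< b → P a → P b → ⊥) →
                ∀ {a b} → P a → P b → a ≡ b
<-exclusive⇒≡ exclusive {a} {b} pa pb with Finₚ.<-cmp a b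
... | tri< a<b _ _ = ⊥-elim (exclusive a<b pa pb)
... | tri≈ _ a≡b _ = a≡b
... | tri> _ _ b<a = ⊥-elim (exclusive b<a pb pa)

module ArcGeometry {n : ℕ} (D : ArcDiagram n) where

  inside-irrefl : ∀ a → ¬ Inside D a a
  inside-irrefl a (la<la , _) = ℕₚ.<-irrefl refl la<la

  inside-trans : ∀ {a b c} → Inside D a b → Inside D b c → Inside D a c
  inside-trans (lb<la , ra<rb) (lc<lb , rb<rc) = ℕₚ.<-trans lc<lb lb<la , ℕₚ.<-trans ra<rb rb<rc

  right-injective : ∀ a b → right D a ≡ right D b → a ≡ b
  right-injective a b ra≡rb with Finₚ.<-cmp a b
  ... | tri< a<b _ _ = ⊥-elim (ℕₚ.<-irrefl ra≡rb (indexing D a b a<b))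
  ... | tri≈ _ a≡b _ = a≡b
  ... | tri> _ _ b<a = ⊥-elim (ℕₚ.<-irrefl (sym ra≡rb) (indexing D b a b<a))

  right<⇒< : ∀ a b → right D a < right D b → a Fin.< b
  right<⇒< a b ra<rb with Finₚ.<-cmp a b
  ... | tri< a<b _ _ = a<b
  ... | tri≈ _ refl _ = ⊥-elim (ℕₚ.<-irrefl refl ra<rb)
  ... | tri> _ _ b<a = ⊥-elim (ℕₚ.<-asym ra<rb (indexing D b a b<a))

  inside⇒< : ∀ {a b} → Inside D a b → a Fin.< b
  inside⇒< {a} {b} (_ , ra<rb) = right<⇒< a b ra<rb

  inside? : ∀ a b → Dec (Inside D a b)
  inside? a b = (left D b ℕₚ.<? left D a) ×-dec (right D a ℕₚ.<? right D b)

  infix 4 _⊑_ _⊑?_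

  _⊑_ : Fin n → Fin n → Set
  a ⊑ s = a ≡ s ⊎ Inside D a s

  _⊑?_ : ∀ a s → Dec (a ⊑ s)
  a ⊑? s = (a Finₚ.≟ s) ⊎-dec inside? a s

  ⊑-bounds : ∀ {a s} → a ⊑ s → left D s ≤ left D a × right D a ≤ right D s
  ⊑-bounds (inj₁ refl) = ℕₚ.≤-refl , ℕₚ.≤-refl
  ⊑-bounds (inj₂ (ls<la , ra<rs)) = ℕₚ.<⇒≤ ls<la , ℕₚ.<⇒≤ ra<rs

  -- Both s and t pass over x, so left t < right s: they cross if right s < right t.
  enclosers-nested-from-left : ∀ {x s t} → x ⊑ s → x ⊑ t → left D s < left D t →
                               s ≡ t ⊎ Inside D t s
  enclosers-nested-from-left {x} {s} {t} x⊑s x⊑t ls<lt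
    with ℕₚ.<-cmp (right D s) (right D t)
  ... | tri< rs<rt _ _ = ⊥-elim (noncrossing D s t (ls<lt , lt<rs , rs<rt))
    where
    lt<rs : left D t < right D s
    lt<rs = ℕₚ.≤-<-trans (proj₁ (⊑-bounds x⊑t))
              (ℕₚ.<-≤-trans (left<right D x) (proj₂ (⊑-bounds x⊑s)))
  ... | tri≈ _ rs≡rt _ = inj₁ (right-injective s t rs≡rt)
  ... | tri> _ _ rt<rs = inj₂ (ls<lt , rt<rs)

  enclosers-nested : ∀ {x s t} → x ⊑ s → x ⊑ t → s ≡ t ⊎ Inside D s t ⊎ Inside D t s
  enclosers-nested {s = s} {t} x⊑s x⊑t with ℕₚ.<-cmp (left D s) (left D t)
  ... | tri≈ _ ls≡lt _ = inj₁ (left-inj D s t ls≡lt)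
  ... | tri< ls<lt _ _ = Sum.map₂ inj₂ (enclosers-nested-from-left x⊑s x⊑t ls<lt)
  ... | tri> _ _ lt<ls = Sum.map sym inj₁ (enclosers-nested-from-left x⊑t x⊑s lt<ls)

  sameRegion-refl : ∀ a → SameRegion D a a
  sameRegion-refl a c = id , id

  sameRegion-sym : ∀ {a b} → SameRegion D a b → SameRegion D b a
  sameRegion-sym a≈b c = Product.swap (a≈b c)

  sameRegion-trans : ∀ {a b c} → SameRegion D a b → SameRegion D b c → SameRegion D a c
  sameRegion-trans a≈b b≈c d =
    (proj₁ (b≈c d) ∘ proj₁ (a≈b d)) , (proj₂ (a≈b d) ∘ proj₂ (b≈c d))

  sameRegion? : ∀ a b → Dec (SameRegion D a b)
  sameRegion? a b = Finₚ.all? λ c →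
    (inside? a c →-dec inside? b c) ×-dec (inside? b c →-dec inside? a c)

  sameRegion⇒¬inside : ∀ {a b} → SameRegion D a b → ¬ Inside D a b
  sameRegion⇒¬inside {b = b} a≈b a<b = inside-irrefl b (proj₁ (a≈b b) a<b)

  ImmediatelyInside : Fin n → Fin n → Set
  ImmediatelyInside a p = Inside D a p × (∀ c → Inside D a c → p ⊑ c)

  immediatelyInside-unique : ∀ {a p q} → ImmediatelyInside a p → ImmediatelyInside a q → p ≡ q
  immediatelyInside-unique (a<p , p-least) (a<q , q-least) with p-least _ a<q | q-least _ a<p
  ... | inj₁ p≡q | _ = p≡q
  ... | inj₂ _ | inj₁ q≡p = sym q≡p
  ... | inj₂ p<q | inj₂ q<p = ⊥-elim (inside-irrefl _ (inside-trans p<q q<p))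

  minimal-encloser-immediate : ∀ {a p} → Minimal (Inside D a) p → ImmediatelyInside a p
  minimal-encloser-immediate {a} {p} (a<p , p-minimal) = a<p , p-least
    where
    p-least : ∀ c → Inside D a c → p ⊑ c
    p-least c a<c with enclosers-nested (inj₂ a<p) (inj₂ a<c)
    ... | inj₁ p≡c = inj₁ p≡c
    ... | inj₂ (inj₁ p<c) = inj₂ p<c
    ... | inj₂ (inj₂ c<p) = ⊥-elim (p-minimal c (inside⇒< c<p) a<c)

  immediate-encloser-or-outermost : ∀ a → ∃ (ImmediatelyInside a) ⊎ (∀ c → ¬ Inside D a c)
  immediate-encloser-or-outermost a =
    Sum.map₁ (Product.map₂ minimal-encloser-immediate) (minimal-or-none (Inside D a) (inside? a))

  sameRegion-immediatelyInside : ∀ {a b p} → SameRegion D a b →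
                                 ImmediatelyInside a p → ImmediatelyInside b p
  sameRegion-immediatelyInside a≈b (a<p , p-least) =
    proj₁ (a≈b _) a<p , λ c b<c → p-least c (proj₂ (a≈b c) b<c)

  immediatelyInside-sameRegion : ∀ {a b p} → ImmediatelyInside a p → ImmediatelyInside b p →
                                 SameRegion D a b
  immediatelyInside-sameRegion {p = p} a◁p b◁p c = transfer a◁p b◁p , transfer b◁p a◁p
    where
    transfer : ∀ {x y} → ImmediatelyInside x p → ImmediatelyInside y p → Inside D x c → Inside D y c
    transfer (_ , p-least) (y<p , _) x<c with p-least c x<c
    ... | inj₁ refl = y<p
    ... | inj₂ p<c = inside-trans y<p p<c

  tieable-sym : ∀ {a b} → Tieable D a b → Tieable D b a
  tieable-sym (a≢b , separated) =
    (a≢b ∘ sym) , λ c c≢b c≢a → Product.swap (separated c c≢a c≢b)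

  sameRegion⇒tieable : ∀ {a b} → a ≢ b → SameRegion D a b → Tieable D a b
  sameRegion⇒tieable a≢b a≈b = a≢b , λ c _ _ → a≈b c

  immediatelyInside⇒tieable : ∀ {a p} → ImmediatelyInside a p → Tieable D a p
  immediatelyInside⇒tieable {a} {p} (a<p , p-least) =
    (λ { refl → inside-irrefl a a<p }) , λ c _ c≢p → transfer c c≢p , λ p<c → inside-trans a<p p<c
    where
    transfer : ∀ c → c ≢ p → Inside D a c → Inside D p c
    transfer c c≢p a<c with p-least c a<c
    ... | inj₁ p≡c = ⊥-elim (c≢p (sym p≡c))
    ... | inj₂ p<c = p<c

  tieable-encloses : ∀ {a b c} → Tieable D a b → Inside D a c → b ⊑ c
  tieable-encloses {a} {b} {c} (_ , separated) a<c with b Finₚ.≟ c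
  ... | yes b≡c = inj₁ b≡c
  ... | no b≢c = inj₂ (proj₁ (separated c (λ { refl → inside-irrefl a a<c }) (b≢c ∘ sym)) a<c)

  tieable-cases : ∀ {a b} → Tieable D a b →
                  SameRegion D a b ⊎ ImmediatelyInside a b ⊎ ImmediatelyInside b a
  tieable-cases {a} {b} t with inside? a b | inside? b a
  ... | yes a<b | _ = inj₂ (inj₁ (a<b , λ _ → tieable-encloses t))
  ... | no _ | yes b<a = inj₂ (inj₂ (b<a , λ _ → tieable-encloses (tieable-sym t)))
  ... | no ¬a<b | no ¬b<a = inj₁ λ c → leaves-with ¬a<b t , leaves-with ¬b<a (tieable-sym t)
    where
    leaves-with : ∀ {x y c} → ¬ Inside D x y → Tieable D x y → Inside D x c → Inside D y c
    leaves-with ¬x<y t x<c with tieable-encloses t x<c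
    ... | inj₁ refl = ⊥-elim (¬x<y x<c)
    ... | inj₂ y<c = y<c

  joins-tieable : (T : TaDiagram D) → ∀ {x w} → Joins (ties T) x w → Tieable D x w
  joins-tieable T (inj₁ xw∈T) = All.lookup (tieable T) xw∈T
  joins-tieable T (inj₂ wx∈T) = tieable-sym (All.lookup (tieable T) wx∈T)

module Components {n : ℕ} where

  joins-sym : ∀ {ts : List (Tie n)} {a b} → Joins ts a b → Joins ts b a
  joins-sym = Sum.swap

  star-sym : ∀ {ts : List (Tie n)} {a b} → Star (Joins ts) a b → Star (Joins ts) b a
  star-sym = Star.reverse joins-sym

  star-weaken : ∀ {t} {ts : List (Tie n)} {a b} → Star (Joins ts) a b → Star (Joins (t ∷ ts)) a b
  star-weaken = Star.map (Sum.map there there)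

  rename : Fin n → Fin n → Fin n → Fin n
  rename new old l with l Finₚ.≟ old
  ... | yes _ = new
  ... | no _ = l

  rename-new : ∀ new old → rename new old new ≡ new
  rename-new new old with new Finₚ.≟ old
  ... | yes _ = refl
  ... | no _ = refl

  rename-old : ∀ new old → rename new old old ≡ new
  rename-old new old with old Finₚ.≟ old
  ... | yes _ = refl
  ... | no old≢old = ⊥-elim (old≢old refl)

  -- Ties are processed from the last one; the tie (a , b) renames the representative
  -- of b's part to that of a's part.
  representative : List (Tie n) → Fin n → Fin n
  representative [] x = x
  representative ((a , b) ∷ ts) x =
    rename (representative ts a) (representative ts b) (representative ts x)

  representative-joins : ∀ ts {a b} → Joins ts a b → representative ts a ≡ representative ts b
  representative-joins ((a , b) ∷ ts) (inj₁ (here refl)) =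
    trans (rename-new (representative ts a) (representative ts b))
          (sym (rename-old (representative ts a) (representative ts b)))
  representative-joins ((a , b) ∷ ts) (inj₂ (here refl)) =
    trans (rename-old (representative ts a) (representative ts b))
          (sym (rename-new (representative ts a) (representative ts b)))
  representative-joins ((a , b) ∷ ts) (inj₁ (there xy∈ts)) =
    cong (rename _ _) (representative-joins ts (inj₁ xy∈ts))
  representative-joins ((a , b) ∷ ts) (inj₂ (there yx∈ts)) =
    cong (rename _ _) (representative-joins ts (inj₂ yx∈ts))

  star⇒same-representative : ∀ ts {x y} → Star (Joins ts) x y →
                             representative ts x ≡ representative ts y
  star⇒same-representative ts ε = refl
  star⇒same-representative ts (xw ◅ w~y) =
    trans (representative-joins ts xw) (star⇒same-representative ts w~y)

  same-representative⇒star : ∀ ts x y → representative ts x ≡ representative ts y →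
                             Star (Joins ts) x y
  same-representative⇒star [] x y refl = ε
  same-representative⇒star ((a , b) ∷ ts) x y x≈y
    with representative ts x Finₚ.≟ representative ts b
       | representative ts y Finₚ.≟ representative ts b
  ... | yes x≈b | yes y≈b = star-weaken (same-representative⇒star ts x y (trans x≈b (sym y≈b)))
  ... | yes x≈b | no _ = star-weaken (same-representative⇒star ts x b x≈b)
                         ◅◅ inj₂ (here refl) ◅ star-weaken (same-representative⇒star ts a y x≈y)
  ... | no _ | yes y≈b = star-weaken (same-representative⇒star ts x a x≈y)
                         ◅◅ inj₁ (here refl)
                         ◅ star-weaken (same-representative⇒star ts b y (sym y≈b))
  ... | no _ | no _ = star-weaken (same-representative⇒star ts x y x≈y)

  star? : ∀ ts x y → Dec (Star (Joins ts) x y)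
  star? ts x y with representative ts x Finₚ.≟ representative ts y
  ... | yes x≈y = yes (same-representative⇒star ts x y x≈y)
  ... | no x≉y = no (x≉y ∘ star⇒same-representative ts)

module UpwardForest {n : ℕ} (up : Fin n → Maybe (Fin n))
                    (up-< : ∀ {a b} → up a ≡ just b → a Fin.< b) where

  Up : Fin n → Fin n → Set
  Up a b = up a ≡ just b

  edges : List (Fin n) → List (Tie n)
  edges [] = []
  edges (a ∷ as) with up a
  ... | just b = (a , b) ∷ edges as
  ... | nothing = edges as

  ∈-edges⁻ : ∀ as {x y} → (x , y) ∈ edges as → Up x y × x ∈ as
  ∈-edges⁻ (a ∷ as) xy∈ with up a in up-a
  ∈-edges⁻ (a ∷ as) (here refl) | just b = up-a , here refl
  ∈-edges⁻ (a ∷ as) (there xy∈) | just b = Product.map₂ there (∈-edges⁻ as xy∈)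
  ∈-edges⁻ (a ∷ as) xy∈ | nothing = Product.map₂ there (∈-edges⁻ as xy∈)

  ∈-edges⁺ : ∀ as {x y} → x ∈ as → Up x y → (x , y) ∈ edges as
  ∈-edges⁺ (a ∷ as) (here refl) up-a rewrite up-a = here refl
  ∈-edges⁺ (a ∷ as) (there x∈as) up-x with up a
  ... | just b = there (∈-edges⁺ as x∈as up-x)
  ... | nothing = ∈-edges⁺ as x∈as up-x

  edges-source-injective : ∀ as → Unique as → ∀ p q →
    proj₁ (lookup (edges as) p) ≡ proj₁ (lookup (edges as) q) → p ≡ q
  edges-source-injective (a ∷ as) (a∉ ∷ unique) p q same with up a
  ... | nothing = edges-source-injective as unique p q same
  edges-source-injective (a ∷ as) (a∉ ∷ unique) Fin.zero Fin.zero same | just b = refl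
  edges-source-injective (a ∷ as) (a∉ ∷ unique) Fin.zero (Fin.suc q) same | just b =
    ⊥-elim (All.lookup a∉ (proj₂ (∈-edges⁻ as (∈-lookup q))) same)
  edges-source-injective (a ∷ as) (a∉ ∷ unique) (Fin.suc p) Fin.zero same | just b =
    ⊥-elim (All.lookup a∉ (proj₂ (∈-edges⁻ as (∈-lookup p))) (sym same))
  edges-source-injective (a ∷ as) (a∉ ∷ unique) (Fin.suc p) (Fin.suc q) same | just b =
    cong Fin.suc (edges-source-injective as unique p q same)

  upTies : List (Tie n)
  upTies = edges (allFin n)

  upTies-all : ∀ {P : Tie n → Set} → (∀ {a b} → Up a b → P (a , b)) → All P upTies
  upTies-all P-up = All.tabulate λ ab∈ → P-up (proj₁ (∈-edges⁻ (allFin n) ab∈))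

  upTies-lookup : ∀ p → Up (proj₁ (lookup upTies p)) (proj₂ (lookup upTies p))
  upTies-lookup p = proj₁ (∈-edges⁻ (allFin n) (∈-lookup p))

  upTies-source-injective : ∀ p q → proj₁ (lookup upTies p) ≡ proj₁ (lookup upTies q) → p ≡ q
  upTies-source-injective = edges-source-injective (allFin n) (allFin⁺ n)

  joins-up⁻ : ∀ {x y} → Joins upTies x y → Up x y ⊎ Up y x
  joins-up⁻ = Sum.map (proj₁ ∘ ∈-edges⁻ (allFin n)) (proj₁ ∘ ∈-edges⁻ (allFin n))

  joins-up⁺ : ∀ {x y} → Up x y → Joins upTies x y
  joins-up⁺ {x} up-x = inj₁ (∈-edges⁺ (allFin n) (∈-allFin x) up-x)

  joins-up-< : ∀ {x y} → x Fin.< y → Joins upTies x y → Up x y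
  joins-up-< x<y xy with joins-up⁻ xy
  ... | inj₁ up-x = up-x
  ... | inj₂ up-y = ⊥-elim (ℕₚ.<-asym x<y (up-< up-y))

  upTies-one-upward : ∀ k j j' → k Fin.< j → k Fin.< j' →
                      Joins upTies k j → Joins upTies k j' → j ≡ j'
  upTies-one-upward k j j' k<j k<j' kj kj' =
    just-injective (trans (sym (joins-up-< k<j kj)) (joins-up-< k<j' kj'))

  NonBacktracking : List (Fin n) → Set
  NonBacktracking (a ∷ b ∷ c ∷ rest) = a ≢ c × NonBacktracking (b ∷ c ∷ rest)
  NonBacktracking _ = ⊤

  lastOf : Fin n → List (Fin n) → Fin n
  lastOf b [] = b
  lastOf b (c ∷ rest) = lastOf c rest

  penultimateOf : Fin n → Fin n → List (Fin n) → Fin n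
  penultimateOf a b [] = a
  penultimateOf a b (c ∷ rest) = penultimateOf b c rest

  lastOf-∈ : ∀ b rest → lastOf b rest ∈ b ∷ rest
  lastOf-∈ b [] = here refl
  lastOf-∈ b (c ∷ rest) = there (lastOf-∈ c rest)

  penultimateOf-∈ : ∀ a b rest → penultimateOf a b rest ∈ a ∷ b ∷ rest
  penultimateOf-∈ a b [] = here refl
  penultimateOf-∈ a b (c ∷ rest) = there (penultimateOf-∈ b c rest)

  lastOf-snoc : ∀ b rest c → lastOf b (rest ++ [ c ]) ≡ c
  lastOf-snoc b [] c = refl
  lastOf-snoc b (d ∷ rest) c = lastOf-snoc d rest c

  penultimateOf-snoc : ∀ a b rest c → penultimateOf a b (rest ++ [ c ]) ≡ lastOf b rest
  penultimateOf-snoc a b [] c = refl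
  penultimateOf-snoc a b (d ∷ rest) c = penultimateOf-snoc b d rest c

  -- Up is a partial function, so after a downward step a non-backtracking
  -- walk cannot turn upwards again.
  descent-continues : ∀ a b rest → Linked (Joins upTies) (a ∷ b ∷ rest) →
    NonBacktracking (a ∷ b ∷ rest) → Up b a →
    Up (lastOf b rest) (penultimateOf a b rest) × lastOf b rest Fin.< a
  descent-continues a b [] _ _ b→a = b→a , up-< b→a
  descent-continues a b (c ∷ rest) (_ ∷ bc ∷ walk) (a≢c , nb) b→a with joins-up⁻ bc
  ... | inj₁ b→c = ⊥-elim (a≢c (just-injective (trans (sym b→a) b→c)))
  ... | inj₂ c→b = Product.map₂ (λ last<b → ℕₚ.<-trans last<b (up-< b→a))
                                (descent-continues b c rest (bc ∷ walk) nb c→b)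

  ascent-or-final-descent : ∀ a b rest → Linked (Joins upTies) (a ∷ b ∷ rest) →
    NonBacktracking (a ∷ b ∷ rest) →
    a Fin.< lastOf b rest ⊎ Up (lastOf b rest) (penultimateOf a b rest)
  ascent-or-final-descent a b [] (ab ∷ _) _ = Sum.map₁ up-< (joins-up⁻ ab)
  ascent-or-final-descent a b (c ∷ rest) (ab ∷ walk) nb with joins-up⁻ ab
  ... | inj₂ b→a = inj₂ (proj₁ (descent-continues a b (c ∷ rest) (ab ∷ walk) nb b→a))
  ... | inj₁ a→b =
        Sum.map₁ (ℕₚ.<-trans (up-< a→b)) (ascent-or-final-descent b c rest walk (proj₂ nb))

  closed-walk-nonBacktracking : ∀ u v rest a → Unique (u ∷ v ∷ rest) →
    a ≢ penultimateOf u v rest → NonBacktracking (u ∷ v ∷ rest ++ [ a ])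
  closed-walk-nonBacktracking u v [] a _ a≢u = a≢u ∘ sym , _
  closed-walk-nonBacktracking u v (w ∷ rest) a ((_ ∷ u≢w ∷ _) ∷ unique) a≢pen =
    u≢w , closed-walk-nonBacktracking v w rest a unique a≢pen

  upTies-acyclic : ∀ (x : Fin n) (xs : List (Fin n)) → Unique (x ∷ xs) → 2 ≤ length xs →
                   ¬ Linked (Joins upTies) (x ∷ xs ++ [ x ])
  upTies-acyclic x [] _ () _
  upTies-acyclic x (y ∷ []) _ (s≤s ()) _
  upTies-acyclic x (y ∷ z ∷ zs) unique@(x∉ ∷ y∉ ∷ _) _ walk@(xy ∷ _) = first-step (joins-up⁻ xy)
    where
    rest = z ∷ zs ++ [ x ]
    nb : NonBacktracking (x ∷ y ∷ rest)
    nb = closed-walk-nonBacktracking x y (z ∷ zs) x unique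
           (All.lookup x∉ (penultimateOf-∈ y z zs))
    first-step : Up x y ⊎ Up y x → ⊥
    first-step (inj₂ y→x) =
      ℕₚ.<-irrefl refl (subst (Fin._< x) (lastOf-snoc y (z ∷ zs) x)
        (proj₂ (descent-continues x y rest walk nb y→x)))
    first-step (inj₁ x→y) with ascent-or-final-descent x y rest walk nb
    ... | inj₁ x<last = ℕₚ.<-irrefl refl (subst (x Fin.<_) (lastOf-snoc y (z ∷ zs) x) x<last)
    ... | inj₂ last→pen = All.lookup y∉ (lastOf-∈ z zs)
          (just-injective (trans (sym x→y)
            (subst₂ Up (lastOf-snoc y (z ∷ zs) x) (penultimateOf-snoc x y (z ∷ zs) x) last→pen)))

module RegionRank {n : ℕ} {D : ArcDiagram n} (T : TaDiagram D) (r : Fin n) where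
  open ArcGeometry D
  open Components

  _~_ : Fin n → Fin n → Set
  _~_ = Connected T

  Node : Fin n → Set
  Node x = SameRegion D r x ⊎ ImmediatelyInside r x

  RegionEncloser : Fin n → Fin n → Set
  RegionEncloser x s = SameRegion D r s × x ⊑ s

  regionEncloser? : ∀ x → Dec (∃ (RegionEncloser x))
  regionEncloser? x = Finₚ.any? λ s → sameRegion? r s ×-dec (x ⊑? s)

  -- Arcs are projected onto the region of r: an arc under an arc s of that
  -- region gets rank s, an arc under no such arc (the boundary of the region
  -- among them) gets rank n, above all arcs of the region.
  rank : Fin n → ℕ
  rank x with regionEncloser? x
  ... | yes (s , _) = toℕ s
  ... | no _ = n

  regionEncloser-unique : ∀ {x s t} → RegionEncloser x s → RegionEncloser x t → s ≡ t
  regionEncloser-unique (r≈s , x⊑s) (r≈t , x⊑t) with enclosers-nested x⊑s x⊑t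
  ... | inj₁ s≡t = s≡t
  ... | inj₂ (inj₁ s<t) =
        ⊥-elim (sameRegion⇒¬inside (sameRegion-trans (sameRegion-sym r≈s) r≈t) s<t)
  ... | inj₂ (inj₂ t<s) =
        ⊥-elim (sameRegion⇒¬inside (sameRegion-trans (sameRegion-sym r≈t) r≈s) t<s)

  rank-regionEncloser : ∀ {x s} → RegionEncloser x s → rank x ≡ toℕ s
  rank-regionEncloser {x} x⊑s with regionEncloser? x
  ... | yes (t , x⊑t) = cong toℕ (regionEncloser-unique x⊑t x⊑s)
  ... | no none = ⊥-elim (none (_ , x⊑s))

  rank-outside : ∀ {x} → ¬ ∃ (RegionEncloser x) → rank x ≡ n
  rank-outside {x} none with regionEncloser? x
  ... | yes encloser = ⊥-elim (none encloser)
  ... | no _ = refl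

  rank≤n : ∀ x → rank x ≤ n
  rank≤n x with regionEncloser? x
  ... | yes (s , _) = ℕₚ.<⇒≤ (Finₚ.toℕ<n s)
  ... | no _ = ℕₚ.≤-refl

  rank-inRegion : ∀ {x} → SameRegion D r x → rank x ≡ toℕ x
  rank-inRegion r≈x = rank-regionEncloser (r≈x , inj₁ refl)

  rank-boundary : ∀ {p} → ImmediatelyInside r p → rank p ≡ n
  rank-boundary {p} (r<p , _) = rank-outside λ { (s , encloser) → no-encloser s encloser }
    where
    no-encloser : ∀ s → ¬ RegionEncloser p s
    no-encloser s (r≈s , inj₁ refl) = inside-irrefl s (proj₁ (r≈s s) r<p)
    no-encloser s (r≈s , inj₂ p<s) = inside-irrefl s (inside-trans (proj₁ (r≈s p) r<p) p<s)

  rank-inRegion-< : ∀ {x y} → SameRegion D r x → SameRegion D r y → x Fin.< y → rank x < rank y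
  rank-inRegion-< r≈x r≈y = subst₂ _<_ (sym (rank-inRegion r≈x)) (sym (rank-inRegion r≈y))

  rank-<-boundary : ∀ {x p} → SameRegion D r x → ImmediatelyInside r p → rank x < rank p
  rank-<-boundary {x} r≈x r◁p =
    subst₂ _<_ (sym (rank-inRegion r≈x)) (sym (rank-boundary r◁p)) (Finₚ.toℕ<n x)

  rank-<⇒< : ∀ {x y} → SameRegion D r x → SameRegion D r y → rank x < rank y → x Fin.< y
  rank-<⇒< r≈x r≈y = subst₂ _<_ (rank-inRegion r≈x) (rank-inRegion r≈y)

  rank-node-injective : ∀ {x y} → Node x → Node y → rank x ≡ rank y → x ≡ y
  rank-node-injective (inj₁ r≈x) (inj₁ r≈y) x≈y =
    Finₚ.toℕ-injective (trans (sym (rank-inRegion r≈x)) (trans x≈y (rank-inRegion r≈y)))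
  rank-node-injective (inj₂ r◁x) (inj₂ r◁y) _ = immediatelyInside-unique r◁x r◁y
  rank-node-injective (inj₁ r≈x) (inj₂ r◁y) x≈y =
    ⊥-elim (ℕₚ.<-irrefl x≈y (rank-<-boundary r≈x r◁y))
  rank-node-injective (inj₂ r◁x) (inj₁ r≈y) x≈y =
    ⊥-elim (ℕₚ.<-irrefl (sym x≈y) (rank-<-boundary r≈y r◁x))

  node-inRegion : ∀ {x} → Node x → rank x < n → SameRegion D r x
  node-inRegion (inj₁ r≈x) _ = r≈x
  node-inRegion (inj₂ r◁x) x<n = ⊥-elim (ℕₚ.<-irrefl (rank-boundary r◁x) x<n)

  rank<n : ∀ {x y} → rank x < rank y → rank x < n
  rank<n {y = y} x<y = ℕₚ.<-≤-trans x<y (rank≤n y)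

  tie-rank-via : ∀ {x w s} → RegionEncloser x s → Tieable D x w →
                 rank x ≡ rank w ⊎ Node x × Node w
  tie-rank-via (r≈x , inj₁ refl) t with tieable-cases t
  ... | inj₁ x≈w = inj₂ (inj₁ r≈x , inj₁ (sameRegion-trans r≈x x≈w))
  ... | inj₂ (inj₁ x◁w) =
        inj₂ (inj₁ r≈x , inj₂ (sameRegion-immediatelyInside (sameRegion-sym r≈x) x◁w))
  ... | inj₂ (inj₂ (w<x , _)) =
        inj₁ (trans (rank-inRegion r≈x) (sym (rank-regionEncloser (r≈x , inj₂ w<x))))
  tie-rank-via {x} {w} {s} (r≈s , inj₂ x<s) t =
    inj₁ (trans (rank-regionEncloser (r≈s , inj₂ x<s)) (sym (rank-regionEncloser (r≈s , w⊑s))))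
    where
    w⊑s : w ⊑ s
    w⊑s with tieable-cases t
    ... | inj₁ x≈w = inj₂ (proj₁ (x≈w s) x<s)
    ... | inj₂ (inj₁ (_ , w-least)) = w-least s x<s
    ... | inj₂ (inj₂ (w<x , _)) = inj₂ (inside-trans w<x x<s)

  tie-rank : ∀ {x w} → Tieable D x w → rank x ≡ rank w ⊎ Node x × Node w
  tie-rank {x} {w} t = by-encloser (regionEncloser? x) (regionEncloser? w)
    where
    by-encloser : Dec (∃ (RegionEncloser x)) → Dec (∃ (RegionEncloser w)) →
                  rank x ≡ rank w ⊎ Node x × Node w
    by-encloser (yes (_ , x⊑s)) _ = tie-rank-via x⊑s t
    by-encloser (no _) (yes (_ , w⊑s)) =
      Sum.map sym Product.swap (tie-rank-via w⊑s (tieable-sym t))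
    by-encloser (no x-out) (no w-out) = inj₁ (trans (rank-outside x-out) (sym (rank-outside w-out)))

  crossing-ties : ∀ {c d e f} → Node c → Node d → Node e → Node f →
    Joins (ties T) c d → Joins (ties T) e f →
    rank c < rank e → rank e < rank d → rank d < rank f → ⊥
  crossing-ties {c} {d} {e} {f} nc nd ne nf cd ef c<e e<d d<f =
    noncross T c e d f (rank-<⇒< r≈c r≈e c<e) (rank-<⇒< r≈e r≈d e<d) (d<f′ nf) cd ef
      (sameRegion-trans (sameRegion-sym r≈c) r≈e)
    where
    d<n = rank<n d<f
    e<n = ℕₚ.<-trans e<d d<n
    r≈d = node-inRegion nd d<n
    r≈e = node-inRegion ne e<n
    r≈c = node-inRegion nc (ℕₚ.<-trans c<e e<n)
    d<f′ : Node f → d Fin.< f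
    d<f′ (inj₁ r≈f) = rank-<⇒< r≈d r≈f d<f
    d<f′ (inj₂ (r<f , _)) = inside⇒< (proj₁ (r≈d f) r<f)

  Outside : ℕ → ℕ → ℕ → Set
  Outside lo hi v = v < lo ⊎ hi < v

  record LeavingTie (x : Fin n) (lo hi : ℕ) : Set where
    constructor leaving
    field
      inner outer : Fin n
      inner-node : Node inner
      outer-node : Node outer
      x~inner : x ~ inner
      tie : Joins (ties T) inner outer
      lo<inner : lo < rank inner
      inner<hi : rank inner < hi
      outer-outside : Outside lo hi (rank outer)

  Avoids : Fin n → ℕ → ℕ → Set
  Avoids x lo hi = ∀ z → Node z → rank z ≡ lo ⊎ rank z ≡ hi → ¬ x ~ z

  leaving-tie-◅ : ∀ {x w lo hi} → Joins (ties T) x w → LeavingTie w lo hi → LeavingTie x lo hi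
  leaving-tie-◅ xw (leaving c d nc nd w~c cd lo<c c<hi d-out) =
    leaving c d nc nd (xw ◅ w~c) cd lo<c c<hi d-out

  avoids-◅ : ∀ {x w lo hi} → Joins (ties T) x w → Avoids x lo hi → Avoids w lo hi
  avoids-◅ xw avoids z nz z-bound w~z = avoids z nz z-bound (xw ◅ w~z)

  -- Along a path, rank changes only across a tie between two nodes.
  leaving-tie : ∀ {x y} lo hi → x ~ y → lo < rank x → rank x < hi →
                Outside lo hi (rank y) → Avoids x lo hi → LeavingTie x lo hi
  leaving-tie lo hi ε lo<x _ (inj₁ x<lo) _ = ⊥-elim (ℕₚ.<-asym lo<x x<lo)
  leaving-tie lo hi ε _ x<hi (inj₂ hi<x) _ = ⊥-elim (ℕₚ.<-asym x<hi hi<x)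
  leaving-tie {x} lo hi (_◅_ {j = w} xw w~y) lo<x x<hi y-out avoids
    with tie-rank (joins-tieable T xw)
  ... | inj₁ x≡w =
        leaving-tie-◅ xw (leaving-tie lo hi w~y (subst (lo <_) x≡w lo<x) (subst (_< hi) x≡w x<hi)
                                      y-out (avoids-◅ xw avoids))
  ... | inj₂ (nx , nw) with ℕₚ.<-cmp (rank w) lo
  ...   | tri< w<lo _ _ = leaving x w nx nw ε xw lo<x x<hi (inj₁ w<lo)
  ...   | tri≈ _ w≡lo _ = ⊥-elim (avoids w nw (inj₁ w≡lo) (xw ◅ ε))
  ...   | tri> _ _ lo<w with ℕₚ.<-cmp (rank w) hi
  ...     | tri≈ _ w≡hi _ = ⊥-elim (avoids w nw (inj₂ w≡hi) (xw ◅ ε))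
  ...     | tri> _ _ hi<w = leaving x w nx nw ε xw lo<x x<hi (inj₂ hi<w)
  ...     | tri< w<hi _ _ =
          leaving-tie-◅ xw (leaving-tie lo hi w~y lo<w w<hi y-out (avoids-◅ xw avoids))

  confined : ∀ {a b x y} → Node a → Node b → Joins (ties T) a b →
    rank a < rank x → rank x < rank b → ¬ x ~ a → ¬ x ~ b → x ~ y →
    ¬ Outside (rank a) (rank b) (rank y)
  confined {a} {b} {x} na nb ab a<x x<b x≁a x≁b x~y y-out =
    crosses (leaving-tie (rank a) (rank b) x~y a<x x<b y-out avoids)
    where
    avoids : Avoids x (rank a) (rank b)
    avoids z nz (inj₁ z≡a) x~z = x≁a (subst (x ~_) (rank-node-injective nz na z≡a) x~z)
    avoids z nz (inj₂ z≡b) x~z = x≁b (subst (x ~_) (rank-node-injective nz nb z≡b) x~z)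
    crosses : LeavingTie x (rank a) (rank b) → ⊥
    crosses (leaving c d nc nd _ cd a<c c<b (inj₂ b<d)) =
      crossing-ties na nb nc nd ab cd a<c c<b b<d
    crosses (leaving c d nc nd _ cd a<c c<b (inj₁ d<a)) =
      crossing-ties nd nc na nb (joins-sym cd) ab d<a a<c c<b

  -- No node has rank suc n, so only the lower end of (rank q , suc n) can be left.
  tie-around : ∀ {q x y} → Node q → ¬ x ~ q → x ~ y → rank y < rank q → rank q < rank x →
               LeavingTie x (rank q) (suc n)
  tie-around {q} {x} nq x≁q x~y y<q q<x =
    leaving-tie (rank q) (suc n) x~y q<x (s≤s (rank≤n x)) (inj₁ y<q) avoids
    where
    avoids : Avoids x (rank q) (suc n)
    avoids z nz (inj₁ z≡q) x~z = x≁q (subst (x ~_) (rank-node-injective nz nq z≡q) x~z)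
    avoids z nz (inj₂ z≡1+n) _ = ℕₚ.<-irrefl z≡1+n (s≤s (rank≤n z))

  below-top : ∀ {lo} z → Outside lo (suc n) (rank z) → rank z < lo
  below-top z (inj₁ z<lo) = z<lo
  below-top z (inj₂ 1+n<z) = ⊥-elim (ℕₚ.<-asym 1+n<z (s≤s (rank≤n z)))

  -- The tie b–a of u₁'s part jumps over u₂, and the tie c–d of u₂'s part jumps
  -- over u₃; each part is confined by the other's tie, forcing a = d.
  interleaved-parts : ∀ {u₁ u₂ u₃ u₄} → Node u₂ → Node u₃ →
    rank u₁ < rank u₂ → rank u₂ < rank u₃ → rank u₃ < rank u₄ →
    u₁ ~ u₃ → u₂ ~ u₄ → ¬ u₁ ~ u₂ → ⊥
  interleaved-parts {_} {u₂} {u₃} {u₄} n₂ n₃ l₁₂ l₂₃ l₃₄ u₁~u₃ u₂~u₄ u₁≁u₂ =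
    from-ties (tie-around n₂ (λ u₃~u₂ → u₁≁u₂ (u₁~u₃ ◅◅ u₃~u₂)) (star-sym u₁~u₃) l₁₂ l₂₃)
              (tie-around n₃ (λ u₄~u₃ → u₁≁u₂ (u₁~u₃ ◅◅ star-sym (u₂~u₄ ◅◅ u₄~u₃)))
                          (star-sym u₂~u₄) l₂₃ l₃₄)
    where
    from-ties : LeavingTie u₃ (rank u₂) (suc n) → LeavingTie u₄ (rank u₃) (suc n) → ⊥
    from-ties (leaving b a nb na u₃~b ba u₂<b _ a-out) (leaving c d nc nd u₄~c cd u₃<c _ d-out) =
      u₁≁u₂ (u₁~a ◅◅ subst (_~ u₂) (sym a≡d) (star-sym u₂~d))
      where
      u₁~b = u₁~u₃ ◅◅ u₃~b
      u₁~a = u₁~b ◅◅ ba ◅ ε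
      u₂~c = u₂~u₄ ◅◅ u₄~c
      u₂~d = u₂~c ◅◅ cd ◅ ε
      a≤d : rank a ≤ rank d
      a≤d = ℕₚ.≮⇒≥ λ d<a →
        confined na nb (joins-sym ba) (below-top a a-out) u₂<b
          (λ u₂~a → u₁≁u₂ (u₁~a ◅◅ star-sym u₂~a)) (λ u₂~b → u₁≁u₂ (u₁~b ◅◅ star-sym u₂~b))
          u₂~d (inj₁ d<a)
      d≤a : rank d ≤ rank a
      d≤a = ℕₚ.≮⇒≥ λ a<d →
        confined nd nc (joins-sym cd) (below-top d d-out) u₃<c
          (λ u₃~d → u₁≁u₂ (u₁~u₃ ◅◅ u₃~d ◅◅ star-sym u₂~d))
          (λ u₃~c → u₁≁u₂ (u₁~u₃ ◅◅ u₃~c ◅◅ star-sym u₂~c))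
          (star-sym u₁~u₃ ◅◅ u₁~a) (inj₁ a<d)
      a≡d : a ≡ d
      a≡d = rank-node-injective na nd (ℕₚ.≤-antisym a≤d d≤a)

module StandardForm {n : ℕ} {D : ArcDiagram n} (T : TaDiagram D) where
  open ArcGeometry D
  open Components

  _~_ : Fin n → Fin n → Set
  _~_ = Connected T

  connected? : ∀ x y → Dec (x ~ y)
  connected? = star? (ties T)

  PartSibling : Fin n → Fin n → Set
  PartSibling a s = a Fin.< s × SameRegion D a s × a ~ s

  partSibling? : ∀ a s → Dec (PartSibling a s)
  partSibling? a s = (toℕ a ℕₚ.<? toℕ s) ×-dec sameRegion? a s ×-dec connected? a s

  FirstPartSibling : Fin n → Fin n → Set
  FirstPartSibling a = Minimal (PartSibling a)

  PartParent : Fin n → Fin n → Set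
  PartParent a p = (∀ s → ¬ PartSibling a s) × ImmediatelyInside a p × a ~ p

  UpperSpec : Fin n → Fin n → Set
  UpperSpec a b = FirstPartSibling a b ⊎ PartParent a b

  NoUpper : Fin n → Set
  NoUpper a = (∀ s → ¬ PartSibling a s) × (∀ p → ImmediatelyInside a p → ¬ a ~ p)

  upper-choice : ∀ a → ∃ (UpperSpec a) ⊎ NoUpper a
  upper-choice a with minimal-or-none (PartSibling a) (partSibling? a)
  ... | inj₁ (s , first) = inj₁ (s , inj₁ first)
  ... | inj₂ none with immediate-encloser-or-outermost a
  ...   | inj₂ outermost = inj₂ (none , λ p a◁p _ → outermost p (proj₁ a◁p))
  ...   | inj₁ (p , a◁p) with connected? a p
  ...     | yes a~p = inj₁ (p , inj₂ (none , a◁p , a~p))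
  ...     | no a≁p = inj₂ (none , λ q a◁q a~q →
                               a≁p (subst (a ~_) (immediatelyInside-unique a◁q a◁p) a~q))

  upper : Fin n → Maybe (Fin n)
  upper a with upper-choice a
  ... | inj₁ (b , _) = just b
  ... | inj₂ _ = nothing

  upper-view : ∀ a → (Σ (Fin n) λ b → upper a ≡ just b × UpperSpec a b)
                     ⊎ (upper a ≡ nothing × NoUpper a)
  upper-view a with upper-choice a
  ... | inj₁ (b , spec) = inj₁ (b , refl , spec)
  ... | inj₂ none = inj₂ (refl , none)

  upper-spec : ∀ {a b} → upper a ≡ just b → UpperSpec a b
  upper-spec {a} up-a with upper-view a
  ... | inj₁ (b , up-a′ , spec) = subst (UpperSpec a) (just-injective (trans (sym up-a′) up-a)) spec
  ... | inj₂ (no-up , _) with trans (sym up-a) no-up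
  ...   | ()

  upperSpec-< : ∀ {a b} → UpperSpec a b → a Fin.< b
  upperSpec-< (inj₁ ((a<b , _) , _)) = a<b
  upperSpec-< (inj₂ (_ , a◁b , _)) = inside⇒< (proj₁ a◁b)

  upperSpec-~ : ∀ {a b} → UpperSpec a b → a ~ b
  upperSpec-~ (inj₁ ((_ , _ , a~b) , _)) = a~b
  upperSpec-~ (inj₂ (_ , _ , a~b)) = a~b

  upperSpec-tieable : ∀ {a b} → UpperSpec a b → Tieable D a b
  upperSpec-tieable (inj₁ ((a<b , a≈b , _) , _)) = sameRegion⇒tieable (Finₚ.<⇒≢ a<b) a≈b
  upperSpec-tieable (inj₂ (_ , a◁b , _)) = immediatelyInside⇒tieable a◁b

  open UpwardForest upper (upperSpec-< ∘ upper-spec)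

  specs-noncrossing : ∀ {i j k m} → i Fin.< j → j Fin.< k → k Fin.< m → SameRegion D i j →
                      UpperSpec i k → UpperSpec j m → ⊥
  specs-noncrossing {i} {j} i<j j<k k<m i≈j
    (inj₁ ((_ , i≈k , i~k) , k-first)) (inj₁ ((_ , j≈m , j~m) , _))
    with connected? i j
  ... | yes i~j = k-first j j<k (i<j , i≈j , i~j)
  ... | no i≁j = interleaved-parts (inj₁ i≈j) (inj₁ i≈k)
                   (rank-inRegion-< (sameRegion-refl i) i≈j i<j) (rank-inRegion-< i≈j i≈k j<k)
                   (rank-inRegion-< i≈k (sameRegion-trans i≈j j≈m) k<m) i~k j~m i≁j
    where open RegionRank T i
  specs-noncrossing {i} {j} i<j j<k k<m i≈j
    (inj₁ ((_ , i≈k , i~k) , _)) (inj₂ (j-none , j◁m , j~m))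
    with connected? i j
  ... | yes i~j = j-none _ (j<k , sameRegion-trans (sameRegion-sym i≈j) i≈k , star-sym i~j ◅◅ i~k)
  ... | no i≁j = interleaved-parts (inj₁ i≈j) (inj₁ i≈k)
                   (rank-inRegion-< (sameRegion-refl i) i≈j i<j) (rank-inRegion-< i≈j i≈k j<k)
                   (rank-<-boundary i≈k (sameRegion-immediatelyInside (sameRegion-sym i≈j) j◁m))
                   i~k j~m i≁j
    where open RegionRank T i
  specs-noncrossing _ _ k<m i≈j (inj₂ (_ , i◁k , _)) (inj₁ ((_ , j≈m , _) , _)) =
    ℕₚ.<-asym k<m (inside⇒< (proj₁ m◁k))
    where
    m◁k = sameRegion-immediatelyInside j≈m (sameRegion-immediatelyInside i≈j i◁k)
  specs-noncrossing _ _ k<m i≈j (inj₂ (_ , i◁k , _)) (inj₂ (_ , j◁m , _))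
    with immediatelyInside-unique j◁m (sameRegion-immediatelyInside i≈j i◁k)
  ... | refl = ℕₚ.<-irrefl refl k<m

  standardForm : TaDiagram D
  standardForm = record
    { ties = upTies
    ; tieable = upTies-all (upperSpec-tieable ∘ upper-spec)
    ; noncross = λ i j k m i<j j<k k<m ik jm i≈j →
        specs-noncrossing i<j j<k k<m i≈j
          (upper-spec (joins-up-< (ℕₚ.<-trans i<j j<k) ik))
          (upper-spec (joins-up-< (ℕₚ.<-trans j<k k<m) jm))
    }

  _~ᵘ_ : Fin n → Fin n → Set
  _~ᵘ_ = Connected standardForm

  upConnected⇒connected : ∀ {x y} → x ~ᵘ y → x ~ y
  upConnected⇒connected ε = ε
  upConnected⇒connected (xw ◅ w~y) with joins-up⁻ xw
  ... | inj₁ x→w = upperSpec-~ (upper-spec x→w) ◅◅ upConnected⇒connected w~y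
  ... | inj₂ w→x = star-sym (upperSpec-~ (upper-spec w→x)) ◅◅ upConnected⇒connected w~y

  sibling-chain : ∀ {u v} → Acc Fin._>_ u → PartSibling u v → u ~ᵘ v
  sibling-chain {u} {v} (acc later) (u<v , u≈v , u~v) with upper-view u
  ... | inj₂ (_ , none , _) = ⊥-elim (none v (u<v , u≈v , u~v))
  ... | inj₁ (b , _ , inj₂ (none , _)) = ⊥-elim (none v (u<v , u≈v , u~v))
  ... | inj₁ (b , u→b , inj₁ ((u<b , u≈b , u~b) , b-first)) with Finₚ.<-cmp b v
  ...   | tri< b<v _ _ = joins-up⁺ u→b ◅ sibling-chain (later u<b)
                           (b<v , sameRegion-trans (sameRegion-sym u≈b) u≈v , star-sym u~b ◅◅ u~v)
  ...   | tri≈ _ refl _ = joins-up⁺ u→b ◅ ε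
  ...   | tri> _ _ v<b = ⊥-elim (b-first v v<b (u<v , u≈v , u~v))

  parent-chain : ∀ {x p} → Acc Fin._>_ x → ImmediatelyInside x p → x ~ p → x ~ᵘ p
  parent-chain {x} {p} (acc later) x◁p x~p with upper-view x
  ... | inj₂ (_ , _ , no-parent) = ⊥-elim (no-parent p x◁p x~p)
  ... | inj₁ (b , x→b , inj₂ (_ , x◁b , _)) =
        subst (x ~ᵘ_) (immediatelyInside-unique x◁b x◁p) (joins-up⁺ x→b ◅ ε)
  ... | inj₁ (b , x→b , inj₁ ((x<b , x≈b , x~b) , _)) =
        joins-up⁺ x→b ◅ parent-chain (later x<b) (sameRegion-immediatelyInside x≈b x◁p)
                                      (star-sym x~b ◅◅ x~p)

  tieable-connected⇒upConnected : ∀ {u v} → Tieable D u v → u ~ v → u ~ᵘ v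
  tieable-connected⇒upConnected {u} {v} t u~v with tieable-cases t
  ... | inj₂ (inj₁ u◁v) = parent-chain (>-wellFounded u) u◁v u~v
  ... | inj₂ (inj₂ v◁u) = star-sym (parent-chain (>-wellFounded v) v◁u (star-sym u~v))
  ... | inj₁ u≈v with Finₚ.<-cmp u v
  ...   | tri< u<v _ _ = sibling-chain (>-wellFounded u) (u<v , u≈v , u~v)
  ...   | tri≈ _ u≡v _ = ⊥-elim (proj₁ t u≡v)
  ...   | tri> _ _ v<u =
          star-sym (sibling-chain (>-wellFounded v) (v<u , sameRegion-sym u≈v , star-sym u~v))

  connected⇒upConnected : ∀ {x y} → x ~ y → x ~ᵘ y
  connected⇒upConnected ε = ε
  connected⇒upConnected (xw ◅ w~y) =
    tieable-connected⇒upConnected (joins-tieable T xw) (xw ◅ ε) ◅◅ connected⇒upConnected w~y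

  equivalent : Equivalent T standardForm
  equivalent _ _ = connected⇒upConnected , upConnected⇒connected

  atMostOneTie : AtMostOneTie standardForm
  atMostOneTie p q (inj₁ (same-source , _)) = upTies-source-injective p q same-source
  atMostOneTie p q (inj₂ (a≡d , b≡c)) =
    ⊥-elim (ℕₚ.<-asym (up-< p) (subst₂ Fin._<_ (sym b≡c) (sym a≡d) (up-< q)))
    where
    up-< : ∀ p → proj₁ (lookup upTies p) Fin.< proj₂ (lookup upTies p)
    up-< p = upperSpec-< (upper-spec (upTies-lookup p))

  lower-outside-first : ∀ {j k} → j Fin.< k → Joins upTies j k → ¬ Inside D j k →
                        FirstPartSibling j k
  lower-outside-first j<k jk j≮k with upper-spec (joins-up-< j<k jk)
  ... | inj₁ first = first
  ... | inj₂ (_ , j◁k , _) = ⊥-elim (j≮k (proj₁ j◁k))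

  lower-inside-parent : ∀ {j k} → j Fin.< k → Joins upTies j k → Inside D j k → PartParent j k
  lower-inside-parent j<k jk j<ₖk with upper-spec (joins-up-< j<k jk)
  ... | inj₂ parent = parent
  ... | inj₁ ((_ , j≈k , _) , _) = ⊥-elim (sameRegion⇒¬inside j≈k j<ₖk)

  first-siblings-exclusive : ∀ {k a b} → a Fin.< b → FirstPartSibling a k → FirstPartSibling b k → ⊥
  first-siblings-exclusive a<b ((_ , a≈k , a~k) , k-first) ((b<k , b≈k , b~k) , _) =
    k-first _ b<k (a<b , sameRegion-trans a≈k (sameRegion-sym b≈k) , a~k ◅◅ star-sym b~k)

  part-parents-exclusive : ∀ {k a b} → a Fin.< b → PartParent a k → PartParent b k → ⊥
  part-parents-exclusive a<b (a-none , a◁k , a~k) (_ , b◁k , b~k) =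
    a-none _ (a<b , immediatelyInside-sameRegion a◁k b◁k , a~k ◅◅ star-sym b~k)

  standard : Standard standardForm
  standard =
    (atMostOneTie , upTies-acyclic) ,
    upTies-one-upward ,
    (λ k j j' j<k j'<k jk j'k j≮k j'≮k →
      <-exclusive⇒≡ first-siblings-exclusive
        (lower-outside-first j<k jk j≮k) (lower-outside-first j'<k j'k j'≮k)) ,
    (λ k j j' j<k j'<k jk j'k j<ₖk j'<ₖk →
      <-exclusive⇒≡ part-parents-exclusive
        (lower-inside-parent j<k jk j<ₖk) (lower-inside-parent j'<k j'k j'<ₖk))

proposition5 : (n : ℕ) (D : ArcDiagram n) (T : TaDiagram D) →
    Σ (TaDiagram D) (λ T' → Standard T' × Equivalent T T')
proposition5 n D T = standardForm , standard , equivalent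
  where open StandardForm T
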